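{- Each of the following sets of integers is ultimately periodic (i.e. for each set $A$ there exist $n_0$ and $p>0$ such that for all $n\ge n_0$, $n\in A$ if and only if $n+p\in A$): $\{n\ge 0: \mathcal{G}(0,0,n)=1\}$, $\{n\ge 0:\mathcal{G}(0,n,n)=1\}$, $\{n\ge 2: \mathcal{G}(0,2,n)=1\}$, and $\{n\ge 2: \mathcal{G}(0,n-2,n)=1\}$.
   Context: Three-pile Sharing Nim: a position is a triple of nonnegative integers (pile sizes; order irrelevant). A move takes some positive number $k$ of tokens from one pile and adds them to another pile, provided that after the move the receiving pile does not have more tokens than the source pile; i.e. from $(a,b,c)$ with $a\le b\le c$ one may move to $(a+k,b-k,c)$ with $1\le k\le (b-a)/2$, to $(a+k,b,c-k)$ with $1\le k\le (c-a)/2$, or to $(a,b+k,c-k)$ with $1\le k\le (c-b)/2$. Normal play. The Sprague–Grundy value is $\mathcal{G}(p)=\operatorname{mex}\{\mathcal{G}(q): q \text{ reachable from } p \text{ in one move}\}$, where $\operatorname{mex}(S)$ is the least nonnegative integer not in $S$. -}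

module Defs where

open import Data.Nat using (ℕ; zero; suc; _+_; _*_; _∸_; _≤_; _≤ᵇ_; _≡ᵇ_)
open import Data.Bool using (Bool; true; false; if_then_else_)
open import Data.List using (List; []; _∷_; map; upTo; filterᵇ; length; _++_)
open import Data.Bool.ListAction using (any)
open import Data.Product using (_×_; _,_)

Position : Set
Position = ℕ × ℕ × ℕ

-- All results (x' , y') of moving k ≥ 1 tokens from a source pile of size x
-- to a receiving pile of size y, subject to y + k ≤ x - k
-- (the receiving pile does not exceed the source pile afterwards).
transfers : ℕ → ℕ → List (ℕ × ℕ)
transfers x y =
  map (λ k → (x ∸ k , y + k))
      (filterᵇ (λ k → (y + k) ≤ᵇ (x ∸ k)) (map suc (upTo x)))

moves : Position → List Position
moves (a , b , c) =
     map (λ { (a' , b') → (a' , b' , c) }) (transfers a b)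
  ++ map (λ { (b' , a') → (a' , b' , c) }) (transfers b a)
  ++ map (λ { (a' , c') → (a' , b , c') }) (transfers a c)
  ++ map (λ { (c' , a') → (a' , b , c') }) (transfers c a)
  ++ map (λ { (b' , c') → (a , b' , c') }) (transfers b c)
  ++ map (λ { (c' , b') → (a , b' , c') }) (transfers c b)

elem : ℕ → List ℕ → Bool
elem n = any (λ m → m ≡ᵇ n)

-- mex: least natural number not in the list (it is ≤ length of the list).
mex : List ℕ → ℕ
mex l = go (suc (length l)) 0
  where
  go : ℕ → ℕ → ℕ
  go zero    n = n
  go (suc f) n = if elem n l then go f (suc n) else n

grundyF : ℕ → Position → ℕ
grundyF zero    p = 0
grundyF (suc f) p = mex (map (grundyF f) (moves p))

-- Every move strictly decreases a² + b² + c² (by at least 2), so a play from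
-- p has length at most a² + b² + c²; this fuel is therefore sufficient and
-- grundy p is the Sprague–Grundy value G(p) = mex { G(q) : q reachable from p }.
grundy : Position → ℕ
grundy (a , b , c) = grundyF (suc (a * a + b * b + c * c)) (a , b , c)

open import Data.Product using (Σ; ∃; ∃-syntax)
open import Data.Nat using (_<_)
open import Function.Bundles using (_⇔_)

UltimatelyPeriodic : (ℕ → Set) → Set
UltimatelyPeriodic A =
  ∃[ n₀ ] ∃[ p ] (0 < p × (∀ n → n₀ ≤ n → (A n ⇔ A (n + p))))

-- Give a position with piles a ≤ a + x ≤ a + x + y the gaps (x , y).  The effect of a move on the
-- gaps does not depend on a, and permuting the piles changes nothing, so positions with the same gaps
-- are bisimilar and in particular agree on whether their Grundy value is 0 or 1; this reduces
-- everything to a game on gap pairs.  If both gaps are positive, moving from the largest pile to the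
-- smallest one reaches (0 , d) or (d , 0), every option of which is also an option of the original
-- pair, so by strategy stealing the value is not 0.  As every option of (0 , 0), (0 , odd) or
-- (odd , 0) has two positive gaps, these pairs have value 0.  By induction on x + y the pairs of
-- value 1 are exactly (0 , 4t + 2), (2 , 4t + 3), (1 , 1) and their mirror images: no move joins two
-- of them, each has an option among the value-0 pairs above, and every other pair has one of them as
-- an option or is itself one of those value-0 pairs.  The four sets of the theorem have gaps
-- (0 , n), (n , 0), (2 , n ∸ 2) and (n ∸ 2 , 2), hence are residue classes modulo 4 from n = 3 on.

module Submission where

open import Defs
open import Data.Bool using (true; false; if_then_else_)
open import Data.Bool.Properties using (T-≡)
open import Data.Empty using (⊥-elim)
open import Data.Fin using (zero; suc)
open import Data.List using (List; []; _∷_; map; length; upTo; _++_)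
open import Data.List.Membership.Propositional using (_∈_; _∉_)
open import Data.List.Membership.Propositional.Properties
  using (∈-map⁻; ∈-map⁺; ∈-++⁻; ∈-++⁺ˡ; ∈-++⁺ʳ; ∈-filter⁻; ∈-filter⁺; ∈-upTo⁻; ∈-upTo⁺)
open import Data.List.Properties using (map-cong-local)
open import Data.List.Relation.Unary.All as All using ()
open import Data.List.Relation.Unary.Any as Any using ()
open import Data.List.Relation.Unary.Any.Properties using (any⇔)
open import Data.Nat
  using (ℕ; zero; suc; _+_; _*_; _∸_; _≤_; _<_; z≤n; s≤s; _≡ᵇ_; _≤ᵇ_; _%_; NonZero; >-nonZero⁻¹)
open import Data.Nat.DivMod using ([m+kn]%n≡m%n; [m+n]%n≡m%n; m≡m%n+[m/n]*n; _/_; _divMod_; result)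
open import Data.Nat.Properties
open import Data.Nat.Tactic.RingSolver using (solve)
open import Data.Product using (_×_; _,_; ∃-syntax; proj₁; proj₂; swap)
open import Data.Sum using (_⊎_; inj₁; inj₂; [_,_]′)
open import Function.Base using (_∘_)
open import Function.Bundles using (_⇔_; mk⇔; Equivalence)
import Function.Properties.Equivalence as ⇔
open import Relation.Binary.Construct.Closure.ReflexiveTransitive as Star using (Star; ε; _◅_; _◅◅_)
open import Relation.Binary.PropositionalEquality
open import Relation.Nullary using (¬_; yes; no; contradiction)
open import Relation.Nullary.Decidable using (T?)

open import Algebra.Properties.CommutativeSemigroup +-commutativeSemigroup using (xy∙z≈xz∙y)
open import Data.List.Membership.DecPropositional _≟_ using (_∈?_)
open Equivalence using (to; from)

-- mex

-- `mex` runs a loop local to its definition; solving the meta `search` by unification names that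
-- loop, so that `mex l` unfolds to `search l (suc (length l)) 0`.
mutual
  search : List ℕ → ℕ → ℕ → ℕ
  search = _

  mex-unfold : ∀ l → mex l ≡ (if elem 0 l then search l (length l) 1 else 0)
  mex-unfold l with elem 0 l | length l
  ... | _ | _ with 1
  ... | _ = refl

search-≥ : ∀ l f n → n ≤ search l f n
search-≥ l zero    n = ≤-refl
search-≥ l (suc f) n with elem n l
... | true  = ≤-trans (n≤1+n n) (search-≥ l f (suc n))
... | false = ≤-refl

∈⇔elem : ∀ {n} l → n ∈ l ⇔ elem n l ≡ true
∈⇔elem {n} l = mk⇔
  (to T-≡ ∘ to (any⇔ {p = _≡ᵇ n}) ∘ Any.map (λ { refl → ≡⇒≡ᵇ n n refl }))
  (Any.map (λ {m} m≡ᵇn → sym (≡ᵇ⇒≡ m n m≡ᵇn)) ∘ from any⇔ ∘ from T-≡)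

∉⇒elem≡false : ∀ {n} l → n ∉ l → elem n l ≡ false
∉⇒elem≡false {n} l n∉l with elem n l in eq
... | true  = contradiction (from (∈⇔elem l) eq) n∉l
... | false = refl

search-step : ∀ l f n → elem n l ≡ true → search l (suc f) n ≡ search l f (suc n)
search-step l f n n∈l rewrite n∈l = refl

search-stop : ∀ l f n → elem n l ≡ false → search l (suc f) n ≡ n
search-stop l f n n∉l rewrite n∉l = refl

0∈⇒mex≡search : ∀ {l} → 0 ∈ l → mex l ≡ search l (length l) 1
0∈⇒mex≡search {l} 0∈l rewrite mex-unfold l | to (∈⇔elem l) 0∈l = refl

0∉⇒mex≡0 : ∀ {l} → 0 ∉ l → mex l ≡ 0
0∉⇒mex≡0 {l} 0∉l rewrite mex-unfold l | ∉⇒elem≡false l 0∉l = refl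

0∈⇒mex≢0 : ∀ {l} → 0 ∈ l → mex l ≢ 0
0∈⇒mex≢0 {l} 0∈l mex≡0 = <⇒≢ (search-≥ l (length l) 1) (trans (sym mex≡0) (0∈⇒mex≡search 0∈l))

0∈⇒1∈⇒mex≢1 : ∀ {l} → 0 ∈ l → 1 ∈ l → mex l ≢ 1
0∈⇒1∈⇒mex≢1 {x ∷ l} 0∈l 1∈l mex≡1 = <⇒≢ (search-≥ (x ∷ l) (length l) 2) (begin
  1                                  ≡⟨ mex≡1 ⟨
  mex (x ∷ l)                        ≡⟨ 0∈⇒mex≡search 0∈l ⟩
  search (x ∷ l) (suc (length l)) 1  ≡⟨ search-step (x ∷ l) (length l) 1 (to (∈⇔elem (x ∷ l)) 1∈l) ⟩
  search (x ∷ l) (length l) 2        ∎)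
  where open ≡-Reasoning

0∈⇒1∉⇒mex≡1 : ∀ {l} → 0 ∈ l → 1 ∉ l → mex l ≡ 1
0∈⇒1∉⇒mex≡1 {x ∷ l} 0∈l 1∉l =
  trans (0∈⇒mex≡search 0∈l) (search-stop (x ∷ l) (length l) 1 (∉⇒elem≡false (x ∷ l) 1∉l))

mex≡0⇔ : ∀ l → mex l ≡ 0 ⇔ 0 ∉ l
mex≡0⇔ l = mk⇔ (λ mex≡0 0∈l → 0∈⇒mex≢0 0∈l mex≡0) 0∉⇒mex≡0

mex≡1⇔ : ∀ l → mex l ≡ 1 ⇔ (0 ∈ l × 1 ∉ l)
mex≡1⇔ l = mk⇔ to′ (λ (0∈l , 1∉l) → 0∈⇒1∉⇒mex≡1 0∈l 1∉l)
  where
  to′ : mex l ≡ 1 → 0 ∈ l × 1 ∉ l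
  to′ mex≡1 with 0 ∈? l
  ... | no 0∉l  = contradiction (trans (sym mex≡1) (0∉⇒mex≡0 0∉l)) λ ()
  ... | yes 0∈l = 0∈l , λ 1∈l → 0∈⇒1∈⇒mex≢1 0∈l 1∈l mex≡1

-- Moves

data Transfer (x y x′ y′ : ℕ) : Set where
  transfer : ∀ j → x ≡ x′ + suc j → y′ ≡ y + suc j → y′ ≤ x′ → Transfer x y x′ y′

∈-transfers⁻ : ∀ {x y x′ y′} → (x′ , y′) ∈ transfers x y → Transfer x y x′ y′
∈-transfers⁻ {x} {y} x′y′∈ with ∈-map⁻ _ x′y′∈
... | k , k∈ , refl with ∈-filter⁻ (λ k → T? ((y + k) ≤ᵇ (x ∸ k))) {xs = map suc (upTo x)} k∈
... | k∈′ , fits with ∈-map⁻ suc k∈′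
... | j , j∈ , refl =
  transfer j (sym (m∸n+n≡m (∈-upTo⁻ j∈))) refl (≤ᵇ⇒≤ (y + suc j) (x ∸ suc j) fits)

∈-transfers⁺ : ∀ {x y x′ y′} → Transfer x y x′ y′ → (x′ , y′) ∈ transfers x y
∈-transfers⁺ {y = y} {x′} (transfer j refl refl fits) =
  subst (λ z → (z , y + suc j) ∈ transfers (x′ + suc j) y) (m+n∸n≡m x′ (suc j))
    (∈-map⁺ _ (∈-filter⁺ (λ k → T? ((y + k) ≤ᵇ ((x′ + suc j) ∸ k)))
      (∈-map⁺ suc (∈-upTo⁺ (m≤n+m (suc j) x′)))
      (≤⇒≤ᵇ (subst (y + suc j ≤_) (sym (m+n∸n≡m x′ (suc j))) fits))))

transfer⇒< : ∀ {x y x′ y′} → Transfer x y x′ y′ → y < x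
transfer⇒< {y = y} {x′} (transfer j refl refl fits) =
  ≤-trans (<-≤-trans (m<m+n y (s≤s z≤n)) fits) (m≤m+n x′ (suc j))

data Move : Position → Position → Set where
  move₁₂ : ∀ {a b c a′ b′} → Transfer a b a′ b′ → Move (a , b , c) (a′ , b′ , c)
  move₂₁ : ∀ {a b c a′ b′} → Transfer b a b′ a′ → Move (a , b , c) (a′ , b′ , c)
  move₁₃ : ∀ {a b c a′ c′} → Transfer a c a′ c′ → Move (a , b , c) (a′ , b , c′)
  move₃₁ : ∀ {a b c a′ c′} → Transfer c a c′ a′ → Move (a , b , c) (a′ , b , c′)
  move₂₃ : ∀ {a b c b′ c′} → Transfer b c b′ c′ → Move (a , b , c) (a , b′ , c′)
  move₃₂ : ∀ {a b c b′ c′} → Transfer c b c′ b′ → Move (a , b , c) (a , b′ , c′)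

∈-block⁺ : ∀ {x y x′ y′} {f : ℕ × ℕ → Position} {xs} →
           Transfer x y x′ y′ → f (x′ , y′) ∈ map f (transfers x y) ++ xs
∈-block⁺ t = ∈-++⁺ˡ (∈-map⁺ _ (∈-transfers⁺ t))

∈-after-block⁺ : ∀ x y {f : ℕ × ℕ → Position} {q xs} → q ∈ xs → q ∈ map f (transfers x y) ++ xs
∈-after-block⁺ x y {f} = ∈-++⁺ʳ (map f (transfers x y))

moves-complete : ∀ {p q} → Move p q → q ∈ moves p
moves-complete {a , b , c} (move₁₂ t) = ∈-block⁺ t
moves-complete {a , b , c} (move₂₁ t) = ∈-after-block⁺ a b (∈-block⁺ t)
moves-complete {a , b , c} (move₁₃ t) = ∈-after-block⁺ a b (∈-after-block⁺ b a (∈-block⁺ t))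
moves-complete {a , b , c} (move₃₁ t) =
  ∈-after-block⁺ a b (∈-after-block⁺ b a (∈-after-block⁺ a c (∈-block⁺ t)))
moves-complete {a , b , c} (move₂₃ t) =
  ∈-after-block⁺ a b (∈-after-block⁺ b a (∈-after-block⁺ a c (∈-after-block⁺ c a (∈-block⁺ t))))
moves-complete {a , b , c} (move₃₂ t) =
  ∈-after-block⁺ a b (∈-after-block⁺ b a (∈-after-block⁺ a c (∈-after-block⁺ c a (∈-after-block⁺ b c
    (∈-map⁺ _ (∈-transfers⁺ t))))))

∈-map-transfers⁻ : ∀ {p x y} {f : ℕ × ℕ → Position} →
                   (∀ {x′ y′} → Transfer x y x′ y′ → Move p (f (x′ , y′))) →
                   ∀ {q} → q ∈ map f (transfers x y) → Move p q
∈-map-transfers⁻ {f = f} move q∈ with ∈-map⁻ f q∈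
... | _ , x′y′∈ , refl = move (∈-transfers⁻ x′y′∈)

∈-blocks⁻ : ∀ {p} x y {f : ℕ × ℕ → Position} {xs} →
            (∀ {x′ y′} → Transfer x y x′ y′ → Move p (f (x′ , y′))) →
            (∀ {q} → q ∈ xs → Move p q) →
            ∀ {q} → q ∈ map f (transfers x y) ++ xs → Move p q
∈-blocks⁻ x y {f} move rest = [ ∈-map-transfers⁻ move , rest ]′ ∘ ∈-++⁻ (map f (transfers x y))

moves-sound : ∀ p {q} → q ∈ moves p → Move p q
moves-sound (a , b , c) =
  ∈-blocks⁻ a b move₁₂ (∈-blocks⁻ b a move₂₁ (∈-blocks⁻ a c move₁₃ (∈-blocks⁻ c a move₃₁
    (∈-blocks⁻ b c move₂₃ (∈-map-transfers⁻ move₃₂)))))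

-- The Grundy recursion

sumOfSquares : Position → ℕ
sumOfSquares (a , b , c) = a * a + b * b + c * c

squares-decrease : ∀ x y k .{{_ : NonZero k}} → y + k ≤ x →
                   x * x + (y + k) * (y + k) < (x + k) * (x + k) + y * y
squares-decrease x y k y+k≤x = begin-strict
  x * x + (y + k) * (y + k)             ≡⟨ solve (x ∷ y ∷ k ∷ []) ⟩
  x * x + y * y + k * k + 2 * (y * k)   <⟨ +-monoʳ-< (x * x + y * y + k * k) (*-monoʳ-< 2 yk<xk) ⟩
  x * x + y * y + k * k + 2 * (x * k)   ≡⟨ solve (x ∷ y ∷ k ∷ []) ⟩
  (x + k) * (x + k) + y * y             ∎
  where
  open ≤-Reasoning
  yk<xk : y * k < x * k
  yk<xk = *-monoˡ-< k (<-≤-trans (m<m+n y (>-nonZero⁻¹ k)) y+k≤x)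

transfer-decreases : ∀ {x y x′ y′} → Transfer x y x′ y′ → x′ * x′ + y′ * y′ < x * x + y * y
transfer-decreases {y = y} {x′} (transfer j refl refl fits) = squares-decrease x′ y (suc j) fits

transfer-decreases′ : ∀ {x y x′ y′} → Transfer y x y′ x′ → x′ * x′ + y′ * y′ < x * x + y * y
transfer-decreases′ {x} {y} {x′} {y′} t =
  subst₂ _<_ (+-comm (y′ * y′) (x′ * x′)) (+-comm (y * y) (x * x)) (transfer-decreases t)

<-outer-pair : ∀ u v w u′ w′ → u′ + w′ < u + w → u′ + v + w′ < u + v + w
<-outer-pair u v w u′ w′ = subst₂ _<_ (xy∙z≈xz∙y u′ w′ v) (xy∙z≈xz∙y u w v) ∘ +-monoˡ-< v

<-inner-pair : ∀ u v w v′ w′ → v′ + w′ < v + w → u + v′ + w′ < u + v + w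
<-inner-pair u v w v′ w′ = subst₂ _<_ (sym (+-assoc u v′ w′)) (sym (+-assoc u v w)) ∘ +-monoʳ-< u

move-decreases : ∀ {p q} → Move p q → sumOfSquares q < sumOfSquares p
move-decreases {a , b , c} (move₁₂ t) = +-monoˡ-< (c * c) (transfer-decreases t)
move-decreases {a , b , c} (move₂₁ t) = +-monoˡ-< (c * c) (transfer-decreases′ t)
move-decreases {a , b , c} (move₁₃ {a′ = a′} {c′} t) =
  <-outer-pair (a * a) (b * b) (c * c) (a′ * a′) (c′ * c′) (transfer-decreases t)
move-decreases {a , b , c} (move₃₁ {a′ = a′} {c′} t) =
  <-outer-pair (a * a) (b * b) (c * c) (a′ * a′) (c′ * c′) (transfer-decreases′ t)
move-decreases {a , b , c} (move₂₃ {b′ = b′} {c′} t) =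
  <-inner-pair (a * a) (b * b) (c * c) (b′ * b′) (c′ * c′) (transfer-decreases t)
move-decreases {a , b , c} (move₃₂ {b′ = b′} {c′} t) =
  <-inner-pair (a * a) (b * b) (c * c) (b′ * b′) (c′ * c′) (transfer-decreases′ t)

grundyF-stable : ∀ f g p → sumOfSquares p < f → sumOfSquares p < g → grundyF f p ≡ grundyF g p
grundyF-stable (suc f) (suc g) p p<f p<g = cong mex (map-cong-local (All.tabulate λ {q} q∈ →
  let q<p = move-decreases (moves-sound p q∈) in
  grundyF-stable f g q (<-≤-trans q<p (≤-pred p<f)) (<-≤-trans q<p (≤-pred p<g))))

grundy-unfold : ∀ p → grundy p ≡ mex (map grundy (moves p))
grundy-unfold p = cong mex (map-cong-local (All.tabulate λ {q} q∈ →
  grundyF-stable (sumOfSquares p) (suc (sumOfSquares q)) q (move-decreases (moves-sound p q∈)) ≤-refl))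

OptionOfValue : ℕ → Position → Set
OptionOfValue n p = ∃[ q ] Move p q × grundy q ≡ n

∈-option-values⇔ : ∀ p {n} → n ∈ map grundy (moves p) ⇔ OptionOfValue n p
∈-option-values⇔ p = mk⇔
  (λ n∈ → let q , q∈ , n≡ = ∈-map⁻ grundy n∈ in q , moves-sound p q∈ , sym n≡)
  (λ (q , move , gq≡n) → subst (_∈ _) gq≡n (∈-map⁺ grundy (moves-complete move)))

grundy≡0⇔ : ∀ {p} → grundy p ≡ 0 ⇔ (¬ OptionOfValue 0 p)
grundy≡0⇔ {p} = mk⇔
  (λ g≡0 → to (mex≡0⇔ values) (trans (sym (grundy-unfold p)) g≡0) ∘ from (∈-option-values⇔ p))
  (λ ¬option → trans (grundy-unfold p) (from (mex≡0⇔ values) (¬option ∘ to (∈-option-values⇔ p))))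
  where
  values : List ℕ
  values = map grundy (moves p)

grundy≡1⇔ : ∀ {p} → grundy p ≡ 1 ⇔ (OptionOfValue 0 p × ¬ OptionOfValue 1 p)
grundy≡1⇔ {p} = mk⇔
  (λ g≡1 → let 0∈ , 1∉ = to (mex≡1⇔ values) (trans (sym (grundy-unfold p)) g≡1) in
           to (∈-option-values⇔ p) 0∈ , 1∉ ∘ from (∈-option-values⇔ p))
  (λ (option , ¬option) → trans (grundy-unfold p)
     (from (mex≡1⇔ values) (from (∈-option-values⇔ p) option , ¬option ∘ to (∈-option-values⇔ p))))
  where
  values : List ℕ
  values = map grundy (moves p)

grundy≢0⇒zeroOption : ∀ {p} → grundy p ≢ 0 → OptionOfValue 0 p
grundy≢0⇒zeroOption {p} g≢0 with 0 ∈? map grundy (moves p)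
... | yes 0∈ = to (∈-option-values⇔ p) 0∈
... | no 0∉  = contradiction (trans (grundy-unfold p) (0∉⇒mex≡0 0∉)) g≢0

-- Bisimulations

record Bisimulation (_∼_ : Position → Position → Set) : Set where
  field
    symmetric : ∀ {p p′} → p ∼ p′ → p′ ∼ p
    simulate  : ∀ {p p′ q} → p ∼ p′ → Move p q → ∃[ q′ ] Move p′ q′ × q ∼ q′

module _ {_∼_ : Position → Position → Set} (bisimulation : Bisimulation _∼_) where
  open Bisimulation bisimulation

  private
    -- The simulation is used in both directions, so the induction bounds both positions.
    record Bounded (n : ℕ) (p p′ : Position) : Set where
      constructor bounds
      field
        left  : sumOfSquares p < n
        right : sumOfSquares p′ < n

    options-bounded : ∀ {n p p′ q q′} → Bounded (suc n) p p′ → Move p q → Move p′ q′ → Bounded n q q′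
    options-bounded (bounds p<n p′<n) move move′ = bounds (<-≤-trans (move-decreases move) (≤-pred p<n))
                                                          (<-≤-trans (move-decreases move′) (≤-pred p′<n))

    swap-bounded : ∀ {n p p′} → Bounded n p p′ → Bounded n p′ p
    swap-bounded (bounds p<n p′<n) = bounds p′<n p<n

    zero-bounded : ∀ n {p p′} → Bounded n p p′ → p ∼ p′ → grundy p ≡ 0 → grundy p′ ≡ 0
    zero-bounded (suc n) bounded p∼p′ gp≡0 = from grundy≡0⇔ λ (q′ , move′ , gq′≡0) →
      let q , move , q′∼q = simulate (symmetric p∼p′) move′ in
      to grundy≡0⇔ gp≡0
        (q , move , zero-bounded n (options-bounded (swap-bounded bounded) move′ move) q′∼q gq′≡0)

    one-bounded : ∀ n {p p′} → Bounded n p p′ → p ∼ p′ → grundy p ≡ 1 → grundy p′ ≡ 1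
    one-bounded (suc n) {p′ = p′} bounded p∼p′ gp≡1 = from grundy≡1⇔ (zero-option′ , no-one-option′)
      where
      zero-option′ : OptionOfValue 0 p′
      zero-option′ = let (q , move , gq≡0) , _ = to grundy≡1⇔ gp≡1
                         q′ , move′ , q∼q′ = simulate p∼p′ move in
                     q′ , move′ , zero-bounded n (options-bounded bounded move move′) q∼q′ gq≡0
      no-one-option′ : ¬ OptionOfValue 1 p′
      no-one-option′ (q′ , move′ , gq′≡1) =
        let q , move , q′∼q = simulate (symmetric p∼p′) move′ in
        proj₂ (to grundy≡1⇔ gp≡1)
          (q , move , one-bounded n (options-bounded (swap-bounded bounded) move′ move) q′∼q gq′≡1)

    bounded : ∀ p p′ → Bounded (suc (sumOfSquares p + sumOfSquares p′)) p p′
    bounded p p′ = bounds (s≤s (m≤m+n (sumOfSquares p) (sumOfSquares p′)))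
                          (s≤s (m≤n+m (sumOfSquares p′) (sumOfSquares p)))

  bisimilar⇒grundy≡0⇔ : ∀ {p p′} → p ∼ p′ → grundy p ≡ 0 ⇔ grundy p′ ≡ 0
  bisimilar⇒grundy≡0⇔ {p} {p′} p∼p′ =
    mk⇔ (zero-bounded _ (bounded p p′) p∼p′) (zero-bounded _ (bounded p′ p) (symmetric p∼p′))

  bisimilar⇒grundy≡1⇔ : ∀ {p p′} → p ∼ p′ → grundy p ≡ 1 ⇔ grundy p′ ≡ 1
  bisimilar⇒grundy≡1⇔ {p} {p′} p∼p′ =
    mk⇔ (one-bounded _ (bounded p p′) p∼p′) (one-bounded _ (bounded p′ p) (symmetric p∼p′))

-- Gaps

data Swap : Position → Position → Set where
  swap₁₂ : ∀ {a b c} → Swap (a , b , c) (b , a , c)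
  swap₂₃ : ∀ {a b c} → Swap (a , b , c) (a , c , b)

swap-symmetric : ∀ {p p′} → Swap p p′ → Swap p′ p
swap-symmetric swap₁₂ = swap₁₂
swap-symmetric swap₂₃ = swap₂₃

swap-simulates : ∀ {p p′ q} → Swap p p′ → Move p q → ∃[ q′ ] Move p′ q′ × Swap q q′
swap-simulates swap₁₂ (move₁₂ t) = _ , move₂₁ t , swap₁₂
swap-simulates swap₁₂ (move₂₁ t) = _ , move₁₂ t , swap₁₂
swap-simulates swap₁₂ (move₁₃ t) = _ , move₂₃ t , swap₁₂
swap-simulates swap₁₂ (move₃₁ t) = _ , move₃₂ t , swap₁₂
swap-simulates swap₁₂ (move₂₃ t) = _ , move₁₃ t , swap₁₂
swap-simulates swap₁₂ (move₃₂ t) = _ , move₃₁ t , swap₁₂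
swap-simulates swap₂₃ (move₁₂ t) = _ , move₁₃ t , swap₂₃
swap-simulates swap₂₃ (move₂₁ t) = _ , move₃₁ t , swap₂₃
swap-simulates swap₂₃ (move₁₃ t) = _ , move₁₂ t , swap₂₃
swap-simulates swap₂₃ (move₃₁ t) = _ , move₂₁ t , swap₂₃
swap-simulates swap₂₃ (move₂₃ t) = _ , move₃₂ t , swap₂₃
swap-simulates swap₂₃ (move₃₂ t) = _ , move₂₃ t , swap₂₃

Rearrangement : Position → Position → Set
Rearrangement = Star Swap

rearrangement-symmetric : ∀ {p p′} → Rearrangement p p′ → Rearrangement p′ p
rearrangement-symmetric = Star.reverse swap-symmetric

rearrangement-simulates : ∀ {p p′ q} → Rearrangement p p′ → Move p q →
                          ∃[ q′ ] Move p′ q′ × Rearrangement q q′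
rearrangement-simulates ε move = _ , move , ε
rearrangement-simulates (swap ◅ rearrangement) move =
  let q₁ , move₁ , swap₁ = swap-simulates swap move
      q₂ , move₂ , rearrangement₂ = rearrangement-simulates rearrangement move₁
  in q₂ , move₂ , swap₁ ◅ rearrangement₂

data Gapped (x y : ℕ) : Position → Set where
  gapped : ∀ {a b c} → b ≡ a + x → c ≡ b + y → Gapped x y (a , b , c)

HasGaps : ℕ → ℕ → Position → Set
HasGaps x y p = ∃[ t ] Rearrangement p t × Gapped x y t

-- The effect on the gaps of moving k = suc j tokens from the middle pile to the smallest, from the
-- largest to the middle, and from the largest to the smallest, where in the last case the smallest
-- pile may end up above the middle one (reorder₁₂) or the largest one below it (reorder₂₃).
data GapMove (x y x′ y′ : ℕ) : Set where
  midToSmall             : ∀ j → x ≡ x′ + (suc j + suc j) → y′ ≡ y + suc j → GapMove x y x′ y′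
  largeToMid             : ∀ j → y ≡ y′ + (suc j + suc j) → x′ ≡ x + suc j → GapMove x y x′ y′
  largeToSmall           : ∀ j → x ≡ x′ + suc j → y ≡ y′ + suc j → GapMove x y x′ y′
  largeToSmall-reorder₁₂ : 1 ≤ x′ → y ≡ y′ + x + (x′ + x′) → GapMove x y x′ y′
  largeToSmall-reorder₂₃ : 1 ≤ y′ → x ≡ x′ + y + (y′ + y′) → GapMove x y x′ y′

-- The solver needs both sides of its goal, so the given equation is elaborated first.
sandwich : ∀ {a b c d : ℕ} → b ≡ c → a ≡ b → c ≡ d → a ≡ d
sandwich b≡c a≡b c≡d = trans a≡b (trans b≡c c≡d)

HasOptionGaps : ℕ → ℕ → Position → Set
HasOptionGaps x y q = ∃[ x′ ] ∃[ y′ ] GapMove x y x′ y′ × HasGaps x′ y′ q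

largeToSmall-options : ∀ a x y j d → x + y ≡ d + (suc j + suc j) →
                       HasOptionGaps x y (a + suc j , a + x , a + suc j + d)
largeToSmall-options a x y j d x+y≡ with suc j ≤? x
... | no sj≰x with m≤n⇒∃[o]m+o≡n (≰⇒> sj≰x)
...   | x₃ , refl with +-cancelˡ-≡ x y (d + x + (suc x₃ + suc x₃))
                         (trans x+y≡ (solve (x ∷ x₃ ∷ d ∷ [])))
...     | refl = suc x₃ , d , largeToSmall-reorder₁₂ (s≤s z≤n) refl ,
                 _ , swap₁₂ ◅ ε , gapped (solve (a ∷ x ∷ x₃ ∷ [])) refl
largeToSmall-options a x y j d x+y≡ | yes sj≤x with m≤n⇒∃[o]m+o≡n sj≤x | suc j ≤? y
... | x₁ , refl | yes sj≤y with m≤n⇒∃[o]m+o≡n sj≤y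
...   | y₁ , refl with +-cancelˡ-≡ (suc j + suc j) (x₁ + y₁) d
                         (sandwich x+y≡ (solve (j ∷ x₁ ∷ y₁ ∷ [])) (+-comm d (suc j + suc j)))
...     | refl = x₁ , y₁ , largeToSmall j (+-comm (suc j) x₁) (+-comm (suc j) y₁) ,
                 _ , ε , gapped (sym (+-assoc a (suc j) x₁)) (solve (a ∷ j ∷ x₁ ∷ y₁ ∷ []))
largeToSmall-options a x y j d x+y≡ | yes sj≤x | x₁ , refl | no sj≰y with m≤n⇒∃[o]m+o≡n (≰⇒> sj≰y)
... | y₃ , refl with +-cancelˡ-≡ (suc (y + y + y₃)) x₁ (d + suc y₃)
                     (sandwich x+y≡ (solve (y ∷ y₃ ∷ x₁ ∷ [])) (solve (y ∷ y₃ ∷ d ∷ [])))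
...   | refl = d , suc y₃ , largeToSmall-reorder₂₃ (s≤s z≤n) (solve (y ∷ y₃ ∷ d ∷ [])) ,
               _ , swap₂₃ ◅ ε , gapped refl (solve (a ∷ y ∷ y₃ ∷ d ∷ []))

gapped-options : ∀ {x y p q} → Gapped x y p → Move p q → HasOptionGaps x y q
gapped-options {x} {y} {a , _ , _} (gapped refl refl) = options
  where
  options : ∀ {q} → Move (a , a + x , a + x + y) q → HasOptionGaps x y q
  options (move₁₂ t) = contradiction (transfer⇒< t) (≤⇒≯ (m≤m+n a x))
  options (move₁₃ t) = contradiction (transfer⇒< t) (≤⇒≯ (≤-trans (m≤m+n a x) (m≤m+n (a + x) y)))
  options (move₂₃ t) = contradiction (transfer⇒< t) (≤⇒≯ (m≤m+n (a + x) y))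
  options (move₂₁ (transfer j a+x≡ refl fits)) with m≤n⇒∃[o]m+o≡n fits
  ... | o , refl with +-cancelˡ-≡ a x (o + (suc j + suc j)) (trans a+x≡ (solve (a ∷ j ∷ o ∷ [])))
  ... | refl = o , y + suc j , midToSmall j refl refl ,
               _ , ε , gapped refl (solve (a ∷ o ∷ j ∷ y ∷ []))
  options (move₃₂ (transfer j c≡ refl fits)) with m≤n⇒∃[o]m+o≡n fits
  ... | w , refl with +-cancelˡ-≡ (a + x) y (w + (suc j + suc j)) (trans c≡ (solve (a ∷ x ∷ j ∷ w ∷ [])))
  ... | refl = x + suc j , w , largeToMid j refl refl ,
               _ , ε , gapped (+-assoc a x (suc j)) refl
  options (move₃₁ (transfer j c≡ refl fits)) with m≤n⇒∃[o]m+o≡n fits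
  ... | d , refl = largeToSmall-options a x y j d (+-cancelˡ-≡ a (x + y) (d + (suc j + suc j))
                     (sandwich c≡ (sym (+-assoc a x y)) (solve (a ∷ j ∷ d ∷ []))))

gapped-realise : ∀ {x y x′ y′ p} → Gapped x y p → GapMove x y x′ y′ →
                 ∃[ q ] Move p q × HasGaps x′ y′ q
gapped-realise {x} {y} {x′} {y′} {a , _ , _} (gapped refl refl) = realise
  where
  realise : GapMove x y x′ y′ → ∃[ q ] Move (a , a + x , a + x + y) q × HasGaps x′ y′ q
  realise (midToSmall j refl refl) =
    (a + suc j , a + suc j + x′ , a + x + y) ,
    move₂₁ (transfer j (solve (a ∷ x′ ∷ j ∷ [])) refl (m≤m+n (a + suc j) x′)) ,
    _ , ε , gapped refl (solve (a ∷ x′ ∷ j ∷ y ∷ []))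
  realise (largeToMid j refl refl) =
    (a , a + x + suc j , a + x + suc j + y′) ,
    move₃₂ (transfer j (solve (a ∷ x ∷ j ∷ y′ ∷ [])) refl (m≤m+n (a + x + suc j) y′)) ,
    _ , ε , gapped (+-assoc a x (suc j)) refl
  realise (largeToSmall j refl refl) =
    (a + suc j , a + x , a + suc j + x′ + y′) ,
    move₃₁ (transfer j (solve (a ∷ x′ ∷ j ∷ y′ ∷ [])) refl
             (≤-trans (m≤m+n (a + suc j) x′) (m≤m+n (a + suc j + x′) y′))) ,
    _ , ε , gapped (solve (a ∷ x′ ∷ j ∷ [])) (solve (a ∷ x′ ∷ j ∷ y′ ∷ []))
  realise (largeToSmall-reorder₁₂ (s≤s {n = j} z≤n) refl) =
    (a + suc (x + j) , a + x , a + suc (x + j) + y′) ,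
    move₃₁ (transfer (x + j) (solve (a ∷ x ∷ j ∷ y′ ∷ [])) refl (m≤m+n (a + suc (x + j)) y′)) ,
    _ , swap₁₂ ◅ ε , gapped (solve (a ∷ x ∷ j ∷ [])) refl
  realise (largeToSmall-reorder₂₃ (s≤s {n = j} z≤n) refl) =
    (a + suc (y + j) , a + x , a + suc (y + j) + x′) ,
    move₃₁ (transfer (y + j) (solve (a ∷ x′ ∷ y ∷ j ∷ [])) refl (m≤m+n (a + suc (y + j)) x′)) ,
    _ , swap₂₃ ◅ ε , gapped refl (solve (a ∷ x′ ∷ y ∷ j ∷ []))

hasGaps-options : ∀ {x y p q} → HasGaps x y p → Move p q → HasOptionGaps x y q
hasGaps-options (t , p↝t , gapped-t) move =
  let q′ , move′ , q↝q′ = rearrangement-simulates p↝t move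
      x′ , y′ , gapMove , t′ , q′↝t′ , gapped-t′ = gapped-options gapped-t move′
  in x′ , y′ , gapMove , t′ , q↝q′ ◅◅ q′↝t′ , gapped-t′

hasGaps-realise : ∀ {x y x′ y′ p} → HasGaps x y p → GapMove x y x′ y′ →
                  ∃[ q ] Move p q × HasGaps x′ y′ q
hasGaps-realise (t , p↝t , gapped-t) gapMove =
  let q′ , move′ , t′ , q′↝t′ , gapped-t′ = gapped-realise gapped-t gapMove
      q , move , q′↝q = rearrangement-simulates (rearrangement-symmetric p↝t) move′
  in q , move , t′ , rearrangement-symmetric q′↝q ◅◅ q′↝t′ , gapped-t′

SameGaps : Position → Position → Set
SameGaps p p′ = ∃[ x ] ∃[ y ] HasGaps x y p × HasGaps x y p′

sameGaps-bisimulation : Bisimulation SameGaps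
sameGaps-bisimulation = record
  { symmetric = λ (x , y , gaps , gaps′) → x , y , gaps′ , gaps
  ; simulate  = λ (x , y , gaps , gaps′) move →
      let x′ , y′ , gapMove , gaps-q = hasGaps-options gaps move
          q′ , move′ , gaps-q′ = hasGaps-realise gaps′ gapMove
      in q′ , move′ , x′ , y′ , gaps-q , gaps-q′
  }

gapGrundy : ℕ → ℕ → ℕ
gapGrundy x y = grundy (0 , x , x + y)

hasGaps-canonical : ∀ x y → HasGaps x y (0 , x , x + y)
hasGaps-canonical x y = _ , ε , gapped refl refl

hasGaps⇒grundy≡0⇔ : ∀ {x y p} → HasGaps x y p → grundy p ≡ 0 ⇔ gapGrundy x y ≡ 0
hasGaps⇒grundy≡0⇔ gaps =
  bisimilar⇒grundy≡0⇔ sameGaps-bisimulation (_ , _ , gaps , hasGaps-canonical _ _)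

hasGaps⇒grundy≡1⇔ : ∀ {x y p} → HasGaps x y p → grundy p ≡ 1 ⇔ gapGrundy x y ≡ 1
hasGaps⇒grundy≡1⇔ gaps =
  bisimilar⇒grundy≡1⇔ sameGaps-bisimulation (_ , _ , gaps , hasGaps-canonical _ _)

GapOptionOfValue : ℕ → ℕ → ℕ → Set
GapOptionOfValue n x y = ∃[ x′ ] ∃[ y′ ] GapMove x y x′ y′ × gapGrundy x′ y′ ≡ n

module _ {n} (hasGaps⇒grundy≡n⇔ : ∀ {x y p} → HasGaps x y p → grundy p ≡ n ⇔ gapGrundy x y ≡ n) where
  option⇔gapOption : ∀ {x y} → OptionOfValue n (0 , x , x + y) ⇔ GapOptionOfValue n x y
  option⇔gapOption {x} {y} = mk⇔
    (λ (q , move , gq≡n) →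
       let x′ , y′ , gapMove , gaps = hasGaps-options (hasGaps-canonical x y) move in
       x′ , y′ , gapMove , to (hasGaps⇒grundy≡n⇔ gaps) gq≡n)
    (λ (x′ , y′ , gapMove , g≡n) →
       let q , move , gaps = hasGaps-realise (hasGaps-canonical x y) gapMove in
       q , move , from (hasGaps⇒grundy≡n⇔ gaps) g≡n)

option⇔gapOption₀ : ∀ {x y} → OptionOfValue 0 (0 , x , x + y) ⇔ GapOptionOfValue 0 x y
option⇔gapOption₀ = option⇔gapOption hasGaps⇒grundy≡0⇔

option⇔gapOption₁ : ∀ {x y} → OptionOfValue 1 (0 , x , x + y) ⇔ GapOptionOfValue 1 x y
option⇔gapOption₁ = option⇔gapOption hasGaps⇒grundy≡1⇔

gapGrundy≡0⇔ : ∀ {x y} → gapGrundy x y ≡ 0 ⇔ (¬ GapOptionOfValue 0 x y)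
gapGrundy≡0⇔ = mk⇔ (λ g≡0 → to grundy≡0⇔ g≡0 ∘ from option⇔gapOption₀)
                   (λ ¬option → from grundy≡0⇔ (¬option ∘ to option⇔gapOption₀))

gapGrundy≡1⇔ : ∀ {x y} → gapGrundy x y ≡ 1 ⇔ (GapOptionOfValue 0 x y × ¬ GapOptionOfValue 1 x y)
gapGrundy≡1⇔ = mk⇔
  (λ g≡1 → let option , ¬option = to grundy≡1⇔ g≡1 in
           to option⇔gapOption₀ option , ¬option ∘ from option⇔gapOption₁)
  (λ (option , ¬option) →
     from grundy≡1⇔ (from option⇔gapOption₀ option , ¬option ∘ to option⇔gapOption₁))

gapGrundy≢0⇒zeroOption : ∀ {x y} → gapGrundy x y ≢ 0 → GapOptionOfValue 0 x y
gapGrundy≢0⇒zeroOption = to option⇔gapOption₀ ∘ grundy≢0⇒zeroOption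

-- The gap game

mod-contradiction : ∀ n .{{_ : NonZero n}} r s t u → r % n ≢ s % n → r + t * n ≢ s + u * n
mod-contradiction n r s t u r≢s eq = r≢s (begin
  r % n            ≡⟨ [m+kn]%n≡m%n r t n ⟨
  (r + t * n) % n  ≡⟨ cong (_% n) eq ⟩
  (s + u * n) % n  ≡⟨ [m+kn]%n≡m%n s u n ⟩
  s % n            ∎)
  where open ≡-Reasoning

data OneGaps : ℕ → ℕ → Set where
  zero-twoMod4  : ∀ t → OneGaps 0 (2 + t * 4)
  twoMod4-zero  : ∀ t → OneGaps (2 + t * 4) 0
  two-threeMod4 : ∀ t → OneGaps 2 (3 + t * 4)
  threeMod4-two : ∀ t → OneGaps (3 + t * 4) 2
  one-one       : OneGaps 1 1

-- Only some of the gap pairs of value 0 (for instance (0 , 4) has value 0 too): those all of whose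
-- options have two positive gaps.
data ZeroGaps : ℕ → ℕ → Set where
  zero-zero : ZeroGaps 0 0
  zero-odd  : ∀ u → ZeroGaps 0 (1 + u * 2)
  odd-zero  : ∀ u → ZeroGaps (1 + u * 2) 0

oneGaps-swap : ∀ {x y} → OneGaps x y → OneGaps y x
oneGaps-swap (zero-twoMod4 t)  = twoMod4-zero t
oneGaps-swap (twoMod4-zero t)  = zero-twoMod4 t
oneGaps-swap (two-threeMod4 t) = threeMod4-two t
oneGaps-swap (threeMod4-two t) = two-threeMod4 t
oneGaps-swap one-one           = one-one

zeroGaps-swap : ∀ {x y} → ZeroGaps x y → ZeroGaps y x
zeroGaps-swap zero-zero    = zero-zero
zeroGaps-swap (zero-odd u) = odd-zero u
zeroGaps-swap (odd-zero u) = zero-odd u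

gapMove-swap : ∀ {x y x′ y′} → GapMove x y x′ y′ → GapMove y x y′ x′
gapMove-swap (midToSmall j x≡ y′≡)            = largeToMid j x≡ y′≡
gapMove-swap (largeToMid j y≡ x′≡)            = midToSmall j y≡ x′≡
gapMove-swap (largeToSmall j x≡ y≡)           = largeToSmall j y≡ x≡
gapMove-swap (largeToSmall-reorder₁₂ 1≤x′ y≡) = largeToSmall-reorder₂₃ 1≤x′ y≡
gapMove-swap (largeToSmall-reorder₂₃ 1≤y′ x≡) = largeToSmall-reorder₁₂ 1≤y′ x≡

gapMove-decreases : ∀ {x y x′ y′} → GapMove x y x′ y′ → x′ + y′ < x + y
gapMove-decreases {x} {y} {x′} {y′} = decreases
  where
  open ≤-Reasoning
  decreases : GapMove x y x′ y′ → x′ + y′ < x + y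
  decreases (midToSmall j refl refl) = begin-strict
    x′ + (y + suc j)              <⟨ m<m+n _ (s≤s z≤n) ⟩
    x′ + (y + suc j) + suc j      ≡⟨ solve (x′ ∷ y ∷ j ∷ []) ⟩
    x′ + (suc j + suc j) + y      ∎
  decreases (largeToMid j refl refl) = begin-strict
    x + suc j + y′                <⟨ m<m+n _ (s≤s z≤n) ⟩
    x + suc j + y′ + suc j        ≡⟨ solve (x ∷ y′ ∷ j ∷ []) ⟩
    x + (y′ + (suc j + suc j))    ∎
  decreases (largeToSmall j refl refl) = begin-strict
    x′ + y′                       <⟨ m<m+n _ (s≤s z≤n) ⟩
    x′ + y′ + (suc j + suc j)     ≡⟨ solve (x′ ∷ y′ ∷ j ∷ []) ⟩
    x′ + suc j + (y′ + suc j)     ∎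
  decreases (largeToSmall-reorder₁₂ (s≤s {n = j} z≤n) refl) = begin-strict
    suc j + y′                    <⟨ m<m+n _ (s≤s z≤n) ⟩
    suc j + y′ + suc (x + x + j)  ≡⟨ solve (x ∷ y′ ∷ j ∷ []) ⟩
    x + (y′ + x + (suc j + suc j)) ∎
  decreases (largeToSmall-reorder₂₃ (s≤s {n = j} z≤n) refl) = begin-strict
    x′ + suc j                    <⟨ m<m+n _ (s≤s z≤n) ⟩
    x′ + suc j + suc (y + y + j)  ≡⟨ solve (x′ ∷ y ∷ j ∷ []) ⟩
    x′ + y + (suc j + suc j) + y  ∎

zeroGap-options : ∀ {y x′ y′} → GapMove 0 y x′ y′ → 1 ≤ x′ × y ≡ y′ + (x′ + x′)
zeroGap-options {x′ = x′} (midToSmall j 0≡ _)              = contradiction (sym 0≡) (m+1+n≢0 x′)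
zeroGap-options (largeToMid j y≡ refl)                     = s≤s z≤n , y≡
zeroGap-options {x′ = x′} (largeToSmall j 0≡ _)            = contradiction (sym 0≡) (m+1+n≢0 x′)
zeroGap-options {y′ = y′} (largeToSmall-reorder₁₂ 1≤x′ y≡) = 1≤x′ , trans y≡ (cong (_+ _) (+-identityʳ y′))
zeroGap-options {y} {x′} (largeToSmall-reorder₂₃ (s≤s z≤n) 0≡) = contradiction (sym 0≡) (m+1+n≢0 (x′ + y))

zeroGap-options⊆ : ∀ {x d x′ y′} → GapMove 0 d x′ y′ → GapMove x (x + d) x′ y′
zeroGap-options⊆ {x} {d} {x′} {y′} move with zeroGap-options move
... | 1≤x′ , refl = largeToSmall-reorder₁₂ 1≤x′ (solve (x ∷ x′ ∷ y′ ∷ []))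

zeroGaps₀-options-spread : ∀ {y x′ y′} → ZeroGaps 0 y → GapMove 0 y x′ y′ → 1 ≤ x′ × 1 ≤ y′
zeroGaps₀-options-spread zero-zero move with zeroGap-options move
... | s≤s z≤n , 0≡ = contradiction (sym 0≡) (m+1+n≢0 _)
zeroGaps₀-options-spread {x′ = x′} {zero} (zero-odd u) move with zeroGap-options move
... | _ , odd≡ = ⊥-elim (mod-contradiction 2 1 0 u x′ (λ ()) (trans odd≡ (solve (x′ ∷ []))))
zeroGaps₀-options-spread {y′ = suc _} (zero-odd u) move = proj₁ (zeroGap-options move) , s≤s z≤n

zeroGaps-options-spread : ∀ {x y x′ y′} → ZeroGaps x y → GapMove x y x′ y′ → 1 ≤ x′ × 1 ≤ y′
zeroGaps-options-spread zero-zero    = zeroGaps₀-options-spread zero-zero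
zeroGaps-options-spread (zero-odd u) = zeroGaps₀-options-spread (zero-odd u)
zeroGaps-options-spread (odd-zero u) = swap ∘ zeroGaps₀-options-spread (zero-odd u) ∘ gapMove-swap

StealableOption : ℕ → ℕ → Set
StealableOption x y =
  ∃[ x₀ ] ∃[ y₀ ] GapMove x y x₀ y₀ × (∀ {x′ y′} → GapMove x₀ y₀ x′ y′ → GapMove x y x′ y′)

stealableOption-≤ : ∀ x₀ d → StealableOption (suc x₀) (suc x₀ + d)
stealableOption-≤ x₀ d = 0 , d , largeToSmall x₀ refl (+-comm (suc x₀) d) , zeroGap-options⊆

stealableOption : ∀ {x y} → 1 ≤ x → 1 ≤ y → StealableOption x y
stealableOption {suc x₀} {suc y₀} _ _ with ≤-total x₀ y₀
... | inj₁ x₀≤y₀ with m≤n⇒∃[o]m+o≡n (s≤s x₀≤y₀)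
...   | d , refl = stealableOption-≤ x₀ d
stealableOption {suc x₀} {suc y₀} _ _ | inj₂ y₀≤x₀ with m≤n⇒∃[o]m+o≡n (s≤s y₀≤x₀)
...   | d , refl = let x₁ , y₁ , move , ⊆ = stealableOption-≤ y₀ d in
                   y₁ , x₁ , gapMove-swap move , gapMove-swap ∘ ⊆ ∘ gapMove-swap

oneGaps-zeroOption : ∀ {x y} → OneGaps x y → ∃[ x′ ] ∃[ y′ ] GapMove x y x′ y′ × ZeroGaps x′ y′
oneGaps-zeroOption (zero-twoMod4 t) =
  1 + t * 2 , 0 , largeToMid (t * 2) (solve (t ∷ [])) refl , odd-zero t
oneGaps-zeroOption (twoMod4-zero t) =
  0 , 1 + t * 2 , midToSmall (t * 2) (solve (t ∷ [])) refl , zero-odd t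
oneGaps-zeroOption (two-threeMod4 t) =
  0 , 1 + t * 2 * 2 , largeToSmall 1 refl (solve (t ∷ [])) , zero-odd (t * 2)
oneGaps-zeroOption (threeMod4-two t) =
  1 + t * 2 * 2 , 0 , largeToSmall 1 (solve (t ∷ [])) refl , odd-zero (t * 2)
oneGaps-zeroOption one-one = 0 , 0 , largeToSmall 0 refl refl , zero-zero

oneGaps⇒2≤sum : ∀ {x y} → OneGaps x y → 2 ≤ x + y
oneGaps⇒2≤sum (zero-twoMod4 t)  = s≤s (s≤s z≤n)
oneGaps⇒2≤sum (twoMod4-zero t)  = s≤s (s≤s z≤n)
oneGaps⇒2≤sum (two-threeMod4 t) = s≤s (s≤s z≤n)
oneGaps⇒2≤sum (threeMod4-two t) = s≤s (s≤s z≤n)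
oneGaps⇒2≤sum one-one           = s≤s (s≤s z≤n)

zero-twoMod4-isolated : ∀ {t x′ y′} → GapMove 0 (2 + t * 4) x′ y′ → ¬ OneGaps x′ y′
zero-twoMod4-isolated {t} move target = isolated target (zeroGap-options move)
  where
  isolated : ∀ {x′ y′} → OneGaps x′ y′ → ¬ (1 ≤ x′ × 2 + t * 4 ≡ y′ + (x′ + x′))
  isolated (twoMod4-zero s)  (_ , eq) = mod-contradiction 4 2 0 t (1 + s * 2) (λ ()) (trans eq (solve (s ∷ [])))
  isolated (two-threeMod4 s) (_ , eq) = mod-contradiction 4 2 3 t (1 + s)     (λ ()) (trans eq (solve (s ∷ [])))
  isolated (threeMod4-two s) (_ , eq) = mod-contradiction 4 2 0 t (2 + s * 2) (λ ()) (trans eq (solve (s ∷ [])))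
  isolated one-one           (_ , eq) = mod-contradiction 4 2 3 t 0           (λ ()) eq

2≡x+k+k : ∀ {x j} → 2 ≡ x + (suc j + suc j) → x ≡ 0 × j ≡ 0
2≡x+k+k {0}           {0}     refl = refl , refl
2≡x+k+k {0}           {suc j} eq   = contradiction (suc-injective (suc-injective (sym eq))) (m+1+n≢0 j)
2≡x+k+k {1}           {j}     eq   = contradiction (suc-injective (suc-injective (sym eq))) (m+1+n≢0 j)
2≡x+k+k {suc (suc x)} {j}     eq   = contradiction (suc-injective (suc-injective (sym eq))) (m+1+n≢0 x)

2≡x+k : ∀ {x j} → 2 ≡ x + suc j → (x ≡ 1 × j ≡ 0) ⊎ (x ≡ 0 × j ≡ 1)
2≡x+k {0}           refl = inj₂ (refl , refl)
2≡x+k {1}           refl = inj₁ (refl , refl)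
2≡x+k {suc (suc x)} eq   = contradiction (suc-injective (suc-injective (sym eq))) (m+1+n≢0 x)

two-threeMod4-isolated : ∀ {t x′ y′} → GapMove 2 (3 + t * 4) x′ y′ → ¬ OneGaps x′ y′
two-threeMod4-isolated {t} (midToSmall j x≡ y′≡) target with 2≡x+k+k x≡
two-threeMod4-isolated {t} (midToSmall j x≡ y′≡) (zero-twoMod4 s) | refl , refl =
  mod-contradiction 4 2 0 s (1 + t) (λ ()) (trans y′≡ (solve (t ∷ [])))
two-threeMod4-isolated {t} (largeToMid j y≡ _) (twoMod4-zero s) =
  mod-contradiction 2 1 0 (1 + t * 2) (suc j) (λ ()) (sandwich y≡ (solve (t ∷ [])) (solve (j ∷ [])))
two-threeMod4-isolated {t} (largeToMid j y≡ _) (threeMod4-two s) =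
  mod-contradiction 2 1 0 (1 + t * 2) (2 + j) (λ ()) (sandwich y≡ (solve (t ∷ [])) (solve (j ∷ [])))
two-threeMod4-isolated {t} (largeToSmall j x≡ y≡) target with 2≡x+k x≡
two-threeMod4-isolated {t} (largeToSmall j x≡ y≡) one-one | inj₁ (refl , refl) =
  mod-contradiction 4 3 2 t 0 (λ ()) y≡
two-threeMod4-isolated {t} (largeToSmall j x≡ y≡) (zero-twoMod4 s) | inj₂ (refl , refl) =
  mod-contradiction 4 3 0 t (1 + s) (λ ()) (trans y≡ (solve (s ∷ [])))
two-threeMod4-isolated {t} (largeToSmall-reorder₁₂ _ y≡) (twoMod4-zero s) =
  mod-contradiction 2 1 0 (1 + t * 2) (3 + s * 4) (λ ()) (sandwich y≡ (solve (t ∷ [])) (solve (s ∷ [])))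
two-threeMod4-isolated {t} (largeToSmall-reorder₁₂ _ y≡) (two-threeMod4 s) =
  mod-contradiction 4 3 1 t (2 + s) (λ ()) (trans y≡ (solve (s ∷ [])))
two-threeMod4-isolated {t} (largeToSmall-reorder₁₂ _ y≡) (threeMod4-two s) =
  mod-contradiction 2 1 0 (1 + t * 2) (5 + s * 4) (λ ()) (sandwich y≡ (solve (t ∷ [])) (solve (s ∷ [])))
two-threeMod4-isolated {t} (largeToSmall-reorder₁₂ _ y≡) one-one =
  mod-contradiction 4 3 1 t 1 (λ ()) y≡
two-threeMod4-isolated {t} {x′} {y′} (largeToSmall-reorder₂₃ _ x≡) _ = n≮n 2 (begin
  3                                  ≤⟨ m≤m+n 3 (t * 4) ⟩
  3 + t * 4                          ≤⟨ m≤n+m (3 + t * 4) x′ ⟩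
  x′ + (3 + t * 4)                   ≤⟨ m≤m+n (x′ + (3 + t * 4)) (y′ + y′) ⟩
  x′ + (3 + t * 4) + (y′ + y′)       ≡⟨ x≡ ⟨
  2                                  ∎)
  where open ≤-Reasoning

oneGaps-independent : ∀ {x y x′ y′} → OneGaps x y → GapMove x y x′ y′ → ¬ OneGaps x′ y′
oneGaps-independent (zero-twoMod4 t)  move = zero-twoMod4-isolated {t} move
oneGaps-independent (twoMod4-zero t)  move = zero-twoMod4-isolated {t} (gapMove-swap move) ∘ oneGaps-swap
oneGaps-independent (two-threeMod4 t) move = two-threeMod4-isolated {t} move
oneGaps-independent (threeMod4-two t) move = two-threeMod4-isolated {t} (gapMove-swap move) ∘ oneGaps-swap
oneGaps-independent one-one           move = <⇒≱ (gapMove-decreases move) ∘ oneGaps⇒2≤sum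

OneGapsOption : ℕ → ℕ → Set
OneGapsOption x y = ∃[ x′ ] ∃[ y′ ] GapMove x y x′ y′ × OneGaps x′ y′

Trichotomy : ℕ → ℕ → Set
Trichotomy x y = OneGaps x y ⊎ ZeroGaps x y ⊎ OneGapsOption x y

trichotomy-swap : ∀ {x y} → Trichotomy x y → Trichotomy y x
trichotomy-swap (inj₁ one)                           = inj₁ (oneGaps-swap one)
trichotomy-swap (inj₂ (inj₁ zeroGaps))               = inj₂ (inj₁ (zeroGaps-swap zeroGaps))
trichotomy-swap (inj₂ (inj₂ (x′ , y′ , move , one))) =
  inj₂ (inj₂ (y′ , x′ , gapMove-swap move , oneGaps-swap one))

zero-threeMod4-oneGapsOption : ∀ t → OneGapsOption 0 (3 + t * 4)
zero-threeMod4-oneGapsOption zero    = 1 , 1 , largeToMid 0 refl refl , one-one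
zero-threeMod4-oneGapsOption (suc t) = 2 , 3 + t * 4 , largeToMid 1 (solve (t ∷ [])) refl , two-threeMod4 t

zero-zeroMod4-oneGapsOption : ∀ t → OneGapsOption 0 (4 + t * 4)
zero-zeroMod4-oneGapsOption t with t divMod 2
... | result u zero       refl =
  2 + u * 4 , 0 , largeToMid (1 + u * 4) (solve (u ∷ [])) refl , twoMod4-zero u
... | result u (suc zero) refl =
  3 + u * 4 , 2 , largeToMid (2 + u * 4) (solve (u ∷ [])) refl , threeMod4-two u

trichotomy-zero : ∀ y → Trichotomy 0 y
trichotomy-zero y with y divMod 4
... | result zero    zero                   refl = inj₂ (inj₁ zero-zero)
... | result (suc t) zero                   refl = inj₂ (inj₂ (zero-zeroMod4-oneGapsOption t))
... | result t       (suc zero)             refl =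
  inj₂ (inj₁ (subst (ZeroGaps 0) (cong suc (*-assoc t 2 2)) (zero-odd (t * 2))))
... | result t       (suc (suc zero))       refl = inj₁ (zero-twoMod4 t)
... | result t       (suc (suc (suc zero))) refl = inj₂ (inj₂ (zero-threeMod4-oneGapsOption t))

oneGapsOption⊆ : ∀ {x d} → OneGapsOption 0 d → OneGapsOption x (x + d)
oneGapsOption⊆ (x′ , y′ , move , one) = x′ , y′ , zeroGap-options⊆ move , one

trichotomy-one-oneMod4 : ∀ t → Trichotomy 1 (2 + t * 4)
trichotomy-one-oneMod4 t with t divMod 2
... | result u zero       refl =
  inj₂ (inj₂ (2 + u * 4 , 0 , largeToMid (u * 4) (solve (u ∷ [])) refl , twoMod4-zero u))
... | result u (suc zero) refl =
  inj₂ (inj₂ (3 + u * 4 , 2 , largeToMid (1 + u * 4) (solve (u ∷ [])) refl , threeMod4-two u))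

trichotomy-positive : ∀ x₀ d → Trichotomy (suc x₀) (suc x₀ + d)
trichotomy-positive x₀ d with d divMod 4
trichotomy-positive zero     _ | result zero zero refl = inj₁ one-one
trichotomy-positive (suc x₁) _ | result zero zero refl =
  inj₂ (inj₂ (1 , 1 , largeToSmall x₁ refl (+-identityʳ (2 + x₁)) , one-one))
trichotomy-positive x₀ _ | result (suc t) zero refl =
  inj₂ (inj₂ (oneGapsOption⊆ (zero-zeroMod4-oneGapsOption t)))
trichotomy-positive zero           _ | result t (suc zero) refl = trichotomy-one-oneMod4 t
trichotomy-positive (suc zero)     _ | result t (suc zero) refl = inj₁ (two-threeMod4 t)
trichotomy-positive (suc (suc x₂)) _ | result t (suc zero) refl =
  inj₂ (inj₂ (2 , 3 + t * 4 , largeToSmall x₂ refl (solve (x₂ ∷ t ∷ [])) , two-threeMod4 t))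
trichotomy-positive x₀ _ | result t (suc (suc zero)) refl =
  inj₂ (inj₂ (0 , 2 + t * 4 , largeToSmall x₀ refl (+-comm (suc x₀) (2 + t * 4)) , zero-twoMod4 t))
trichotomy-positive x₀ _ | result t (suc (suc (suc zero))) refl =
  inj₂ (inj₂ (oneGapsOption⊆ (zero-threeMod4-oneGapsOption t)))

trichotomy-≤ : ∀ x d → Trichotomy x (x + d)
trichotomy-≤ zero     d = trichotomy-zero d
trichotomy-≤ (suc x₀) d = trichotomy-positive x₀ d

trichotomy : ∀ x y → Trichotomy x y
trichotomy x y with ≤-total x y
... | inj₁ x≤y with m≤n⇒∃[o]m+o≡n x≤y
...   | d , refl = trichotomy-≤ x d
trichotomy x y | inj₂ y≤x with m≤n⇒∃[o]m+o≡n y≤x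
...   | d , refl = trichotomy-swap (trichotomy-≤ y d)

spread⇒gapGrundy≢0 : ∀ {x y} → 1 ≤ x → 1 ≤ y → gapGrundy x y ≢ 0
spread⇒gapGrundy≢0 1≤x 1≤y g≡0 =
  let x₀ , y₀ , move₀ , options₀⊆ = stealableOption 1≤x 1≤y
      x′ , y′ , move′ , g′≡0 =
        gapGrundy≢0⇒zeroOption λ g₀≡0 → to gapGrundy≡0⇔ g≡0 (x₀ , y₀ , move₀ , g₀≡0)
  in to gapGrundy≡0⇔ g≡0 (x′ , y′ , options₀⊆ move′ , g′≡0)

zeroGaps⇒gapGrundy≡0 : ∀ {x y} → ZeroGaps x y → gapGrundy x y ≡ 0
zeroGaps⇒gapGrundy≡0 zeroGaps = from gapGrundy≡0⇔ λ (x′ , y′ , move , g′≡0) →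
  let 1≤x′ , 1≤y′ = zeroGaps-options-spread zeroGaps move in spread⇒gapGrundy≢0 1≤x′ 1≤y′ g′≡0

gapGrundy≡1⇔oneGaps : ∀ x y → gapGrundy x y ≡ 1 ⇔ OneGaps x y
gapGrundy≡1⇔oneGaps x y = bounded (suc (x + y)) x y ≤-refl
  where
  bounded : ∀ n x y → x + y < n → gapGrundy x y ≡ 1 ⇔ OneGaps x y
  bounded (suc n) x y x+y<n = mk⇔ to′ from′
    where
    ih : ∀ {x′ y′} → GapMove x y x′ y′ → gapGrundy x′ y′ ≡ 1 ⇔ OneGaps x′ y′
    ih move = bounded n _ _ (<-≤-trans (gapMove-decreases move) (≤-pred x+y<n))
    to′ : gapGrundy x y ≡ 1 → OneGaps x y
    to′ g≡1 with trichotomy x y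
    ... | inj₁ one = one
    ... | inj₂ (inj₁ zeroGaps) = contradiction (trans (sym g≡1) (zeroGaps⇒gapGrundy≡0 zeroGaps)) λ ()
    ... | inj₂ (inj₂ (x′ , y′ , move , one′)) =
      contradiction (x′ , y′ , move , from (ih move) one′) (proj₂ (to gapGrundy≡1⇔ g≡1))
    from′ : OneGaps x y → gapGrundy x y ≡ 1
    from′ one = from gapGrundy≡1⇔
      ( (let x′ , y′ , move , zeroGaps = oneGaps-zeroOption one in
         x′ , y′ , move , zeroGaps⇒gapGrundy≡0 zeroGaps)
      , λ (x′ , y′ , move , g′≡1) → oneGaps-independent one move (to (ih move) g′≡1))

-- Periodicity

oneGaps-zero⇔residue : ∀ {n} → OneGaps 0 n ⇔ n % 4 ≡ 2
oneGaps-zero⇔residue {n} = mk⇔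
  (λ { (zero-twoMod4 t) → [m+kn]%n≡m%n 2 t 4 })
  (λ n%4≡2 → subst (OneGaps 0) (sym (trans (m≡m%n+[m/n]*n n 4) (cong (_+ n / 4 * 4) n%4≡2)))
                  (zero-twoMod4 (n / 4)))

-- Stated with x ≡ 2 since matching on `OneGaps 2 y` gets stuck at `2 + t * 4 ≟ 2`.
oneGaps-two⇒residue : ∀ {x y} → OneGaps x y → x ≡ 2 → 1 ≤ y → y % 4 ≡ 3
oneGaps-two⇒residue (two-threeMod4 t) _  _  = [m+kn]%n≡m%n 3 t 4
oneGaps-two⇒residue (twoMod4-zero t)  _  ()
oneGaps-two⇒residue (threeMod4-two t) () _

oneGaps-two⇔residue : ∀ {m} → 1 ≤ m → OneGaps 2 m ⇔ m % 4 ≡ 3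
oneGaps-two⇔residue {m} 1≤m = mk⇔
  (λ one → oneGaps-two⇒residue one refl 1≤m)
  (λ m%4≡3 → subst (OneGaps 2) (sym (trans (m≡m%n+[m/n]*n m 4) (cong (_+ m / 4 * 4) m%4≡3)))
                  (two-threeMod4 (m / 4)))

residue-periodic : ∀ n r → n % 4 ≡ r ⇔ (n + 4) % 4 ≡ r
residue-periodic n r = mk⇔ (trans ([m+n]%n≡m%n n 4)) (trans (sym ([m+n]%n≡m%n n 4)))

oneGaps-zero-periodic : ∀ n → OneGaps 0 n ⇔ OneGaps 0 (n + 4)
oneGaps-zero-periodic n =
  ⇔.trans oneGaps-zero⇔residue (⇔.trans (residue-periodic n 2) (⇔.sym oneGaps-zero⇔residue))

oneGaps-two-periodic : ∀ n → 3 ≤ n → OneGaps 2 (n ∸ 2) ⇔ OneGaps 2 (n + 4 ∸ 2)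
oneGaps-two-periodic (suc (suc m)) (s≤s (s≤s 1≤m)) =
  ⇔.trans (oneGaps-two⇔residue 1≤m)
    (⇔.trans (residue-periodic m 3) (⇔.sym (oneGaps-two⇔residue (≤-trans 1≤m (m≤m+n m 4)))))

ultimatelyPeriodic-via : ∀ {A B : ℕ → Set} n₀ p → 0 < p → (∀ n → n₀ ≤ n → A n ⇔ B n) →
                         (∀ n → n₀ ≤ n → B n ⇔ B (n + p)) → UltimatelyPeriodic A
ultimatelyPeriodic-via n₀ p 0<p A⇔B B-periodic = n₀ , p , 0<p , λ n n₀≤n →
  ⇔.trans (A⇔B n n₀≤n) (⇔.trans (B-periodic n n₀≤n) (⇔.sym (A⇔B (n + p) (≤-trans n₀≤n (m≤m+n n p)))))

grundy≡1⇔-via-gaps : ∀ {p} x y → p ≡ (0 , x , x + y) → grundy p ≡ 1 ⇔ OneGaps x y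
grundy≡1⇔-via-gaps x y refl = gapGrundy≡1⇔oneGaps x y

grundy00n≡1⇔ : ∀ n → grundy (0 , 0 , n) ≡ 1 ⇔ OneGaps 0 n
grundy00n≡1⇔ n = grundy≡1⇔-via-gaps 0 n refl

grundy0nn≡1⇔ : ∀ n → grundy (0 , n , n) ≡ 1 ⇔ OneGaps 0 n
grundy0nn≡1⇔ n = ⇔.trans (grundy≡1⇔-via-gaps n 0 (cong (λ c → 0 , n , c) (sym (+-identityʳ n))))
                         (mk⇔ oneGaps-swap oneGaps-swap)

grundy02n≡1⇔ : ∀ n → 3 ≤ n → (2 ≤ n × grundy (0 , 2 , n) ≡ 1) ⇔ OneGaps 2 (n ∸ 2)
grundy02n≡1⇔ 1             (s≤s ())
grundy02n≡1⇔ (suc (suc m)) _ = ⇔.trans (mk⇔ proj₂ (s≤s (s≤s z≤n) ,_)) (grundy≡1⇔-via-gaps 2 m refl)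

grundy0[n-2]n≡1⇔ : ∀ n → 3 ≤ n → (2 ≤ n × grundy (0 , n ∸ 2 , n) ≡ 1) ⇔ OneGaps 2 (n ∸ 2)
grundy0[n-2]n≡1⇔ 1             (s≤s ())
grundy0[n-2]n≡1⇔ (suc (suc m)) _ =
  ⇔.trans (mk⇔ proj₂ (s≤s (s≤s z≤n) ,_))
    (⇔.trans (grundy≡1⇔-via-gaps m 2 (cong (λ c → 0 , m , c) (+-comm 2 m)))
             (mk⇔ oneGaps-swap oneGaps-swap))

mainTheorem11 :
      UltimatelyPeriodic (λ n → grundy (0 , 0 , n) ≡ 1)
    × UltimatelyPeriodic (λ n → grundy (0 , n , n) ≡ 1)
    × UltimatelyPeriodic (λ n → 2 ≤ n × grundy (0 , 2 , n) ≡ 1)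
    × UltimatelyPeriodic (λ n → 2 ≤ n × grundy (0 , n ∸ 2 , n) ≡ 1)
mainTheorem11 =
    ultimatelyPeriodic-via 0 4 (s≤s z≤n) (λ n _ → grundy00n≡1⇔ n) (λ n _ → oneGaps-zero-periodic n)
  , ultimatelyPeriodic-via 0 4 (s≤s z≤n) (λ n _ → grundy0nn≡1⇔ n) (λ n _ → oneGaps-zero-periodic n)
  , ultimatelyPeriodic-via 3 4 (s≤s z≤n) grundy02n≡1⇔ oneGaps-two-periodic
  , ultimatelyPeriodic-via 3 4 (s≤s z≤n) grundy0[n-2]n≡1⇔ oneGaps-two-periodic
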